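{- Let $\mathbf{W}$ be an $n\times n$ real matrix, let $m\ge1$, and define $\mathbf{W}'=\mathbf{W}\otimes\mathbf{J}_m$, where $\mathbf{J}_m$ is the $m\times m$ all-ones matrix. Then \[ \max_{\mathbf{u},\mathbf{v}\in\{0,1\}^{mn}}\mathbf{u}^T\mathbf{W}'\mathbf{v}=m^2\cdot\max_{\mathbf{x},\mathbf{y}\in\{0,1\}^n}\mathbf{x}^T\mathbf{W}\mathbf{y}. \] Furthermore, if $\mathbf{x},\mathbf{y}\in\{0,1\}^n$ maximize $\mathbf{x}^T\mathbf{W}\mathbf{y}$, then $\mathbf{u}=\mathbf{x}\otimes\mathbf{1}_m$ and $\mathbf{v}=\mathbf{y}\otimes\mathbf{1}_m$ maximize $\mathbf{u}^T\mathbf{W}'\mathbf{v}$.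
   Context: $\otimes$ denotes the Kronecker product and $\mathbf{1}_m$ the all-ones vector of length $m$. -}

module Defs where

open import Level using (Level; _⊔_; suc)
open import Data.Nat as ℕ using (ℕ)
open import Data.Fin using (Fin; quotient)
open import Data.Bool using (Bool; true; false; if_then_else_)
open import Data.Product using (Σ; _×_; _,_)
open import Relation.Binary using (Rel; IsTotalOrder)
open import Algebra.Bundles using (CommutativeRing)
import Algebra.Definitions.RawMonoid as RawMonoidDefs

-- A (totally) ordered commutative ring: the abstract setting containing ℝ.
record OrderedCommutativeRing (c ℓ₁ ℓ₂ : Level) : Set (Level.suc (c ⊔ ℓ₁ ⊔ ℓ₂)) where
  field
    commutativeRing : CommutativeRing c ℓ₁
  open CommutativeRing commutativeRing public
  field
    _≤_          : Rel Carrier ℓ₂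
    isTotalOrder : IsTotalOrder _≈_ _≤_
    +-monoˡ-≤    : ∀ {a b} z → a ≤ b → (a + z) ≤ (b + z)
    *-nonneg     : ∀ {a b} → 0# ≤ a → 0# ≤ b → 0# ≤ (a * b)

module Bilinear {c ℓ₁ ℓ₂} (R : OrderedCommutativeRing c ℓ₁ ℓ₂) where
  open OrderedCommutativeRing R
  open RawMonoidDefs +-rawMonoid public using (sum) renaming (_×_ to _⊛_)

  Matrix : ℕ → Set c
  Matrix n = Fin n → Fin n → Carrier

  BVec : ℕ → Set
  BVec n = Fin n → Bool

  ⟦_⟧ : Bool → Carrier
  ⟦ b ⟧ = if b then 1# else 0#

  bilin : ∀ {n} → BVec n → Matrix n → BVec n → Carrier
  bilin {n} x W y = sum (λ i → sum (λ j → (⟦ x i ⟧ * W i j) * ⟦ y j ⟧))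

  -- W ⊗ J_m, indices of Fin (n * m) read as (i , a) ↦ i * m + a
  kronJ : ∀ {n} (m : ℕ) → Matrix n → Matrix (n ℕ.* m)
  kronJ m W k l = W (quotient m k) (quotient m l)

  kron1 : ∀ {n} (m : ℕ) → BVec n → BVec (n ℕ.* m)
  kron1 m x k = x (quotient m k)

  Maximizes : ∀ {n} → Matrix n → BVec n → BVec n → Set ℓ₂
  Maximizes W x y = ∀ x' y' → bilin x' W y' ≤ bilin x W y

  IsMaxValue : ∀ {n} → Matrix n → Carrier → Set (ℓ₁ ⊔ ℓ₂)
  IsMaxValue {n} W M =
    (Σ (BVec n) λ x → Σ (BVec n) λ y → bilin x W y ≈ M)
    × (∀ x y → bilin x W y ≤ M)

module Submission where

-- Index the rows and columns of W ⊗ J_m by pairs (i , a) with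
-- i : Fin n and a : Fin m (via Fin.combine).  Regrouping the double sum
-- u^T (W ⊗ J_m) v by the "copy" indices a and b shows that
--
--     u^T (W ⊗ J_m) v  =  ∑_a ∑_b (u_a)^T W (v_b),      (u_a)_i = u (combine i a),
--
-- i.e. the value is a sum of m·m values of the original form at the slices u_a, v_b.
-- Two consequences give the theorem:
--   * if every x^T W y is at most M then every u^T (W ⊗ J_m) v is at most m·m·M;
--   * every slice of x ⊗ 1_m is x itself, so (x ⊗ 1_m)^T (W ⊗ J_m) (y ⊗ 1_m)
--     equals m·m · x^T W y; the upper bound is therefore attained.

open import Defs
open import Level using (Level)
open import Data.Nat as ℕ using (ℕ; _≤_)
open import Data.Product using (_×_; _,_; proj₁)
open import Data.Fin using (Fin; zero; suc; quotient; combine; _↑ˡ_; _↑ʳ_)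
open import Data.Fin.Properties using (remQuot-combine)
open import Relation.Binary.PropositionalEquality as ≡ using (_≡_)
open import Relation.Binary.Bundles using (Poset)
open import Relation.Binary.Structures using (IsTotalOrder)
import Algebra.Properties.CommutativeMonoid.Sum as CommutativeMonoidSum
import Algebra.Properties.Monoid.Mult as MonoidMult
import Relation.Binary.Reasoning.Setoid as SetoidReasoning
import Relation.Binary.Reasoning.PartialOrder as PosetReasoning

module KroneckerMaximum {c ℓ₁ ℓ₂} (R : OrderedCommutativeRing c ℓ₁ ℓ₂) where
  open OrderedCommutativeRing R renaming (_≤_ to _≤ᵣ_) hiding (zero)
  open Bilinear R
  open CommutativeMonoidSum +-commutativeMonoid
    using (sum-syntax; ∑-comm; sum-cong-≋; sum-cong-≗; sum-replicate)
  open MonoidMult +-monoid using (×-assocˡ)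

  ≤-poset : Poset c ℓ₁ ℓ₂
  ≤-poset = record { isPartialOrder = IsTotalOrder.isPartialOrder isTotalOrder }

  open Poset ≤-poset using () renaming (refl to ≤-refl)

  +-mono-≤ : ∀ {a b x y} → a ≤ᵣ b → x ≤ᵣ y → (a + x) ≤ᵣ (b + y)
  +-mono-≤ {a} {b} {x} {y} a≤b x≤y = begin
    a + x ≤⟨ +-monoˡ-≤ x a≤b ⟩
    b + x ≈⟨ +-comm b x ⟩
    x + b ≤⟨ +-monoˡ-≤ b x≤y ⟩
    y + b ≈⟨ +-comm y b ⟩
    b + y ∎
    where open PosetReasoning ≤-poset

  sum-≤-⊛ : ∀ k (f : Fin k → Carrier) M → (∀ i → f i ≤ᵣ M) → sum f ≤ᵣ (k ⊛ M)
  sum-≤-⊛ ℕ.zero    f M f≤M = ≤-refl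
  sum-≤-⊛ (ℕ.suc k) f M f≤M =
    +-mono-≤ (f≤M zero) (sum-≤-⊛ k (λ i → f (suc i)) M (λ i → f≤M (suc i)))

  sum-↑ : ∀ a b (f : Fin (a ℕ.+ b) → Carrier) →
    sum f ≈ ∑[ i < a ] f (i ↑ˡ b) + ∑[ j < b ] f (a ↑ʳ j)
  sum-↑ ℕ.zero    b f = sym (+-identityˡ _)
  sum-↑ (ℕ.suc a) b f = begin
    f zero + ∑[ k < a ℕ.+ b ] f (suc k)
      ≈⟨ +-congˡ (sum-↑ a b (λ k → f (suc k))) ⟩
    f zero + (∑[ i < a ] f (suc (i ↑ˡ b)) + ∑[ j < b ] f (suc (a ↑ʳ j)))
      ≈⟨ sym (+-assoc _ _ _) ⟩
    (f zero + ∑[ i < a ] f (suc (i ↑ˡ b))) + ∑[ j < b ] f (suc (a ↑ʳ j)) ∎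
    where open SetoidReasoning setoid

  sum-combine : ∀ n m (f : Fin (n ℕ.* m) → Carrier) →
    sum f ≈ ∑[ a < m ] ∑[ i < n ] f (combine i a)
  sum-combine n m f = trans (by-rows n f) (∑-comm {n} {m} (λ i a → f (combine i a)))
    where
    -- Fin (suc n * m) is Fin m followed by Fin (n * m), and combine respects this.
    by-rows : ∀ n (f : Fin (n ℕ.* m) → Carrier) → sum f ≈ ∑[ i < n ] ∑[ a < m ] f (combine i a)
    by-rows ℕ.zero    f = refl
    by-rows (ℕ.suc n) f =
      trans (sum-↑ m (n ℕ.* m) f) (+-congˡ (by-rows n (λ k → f (m ↑ʳ k))))

  slice : ∀ {n} m → BVec (n ℕ.* m) → Fin m → BVec n
  slice m u a i = u (combine i a)

  quotient-combine : ∀ {n} m (i : Fin n) (a : Fin m) → quotient m (combine i a) ≡ i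
  quotient-combine m i a = ≡.cong proj₁ (remQuot-combine i a)

  bilin-kronJ : ∀ {n} m (W : Matrix n) (u v : BVec (n ℕ.* m)) →
    bilin u (kronJ m W) v ≈ ∑[ a < m ] ∑[ b < m ] bilin (slice m u a) W (slice m v b)
  bilin-kronJ {n} m W u v = begin
    ∑[ k < n ℕ.* m ] ∑[ l < n ℕ.* m ] term k l
      ≈⟨ sum-combine n m _ ⟩
    ∑[ a < m ] ∑[ i < n ] ∑[ l < n ℕ.* m ] term (combine i a) l
      ≈⟨ sum-cong-≋ (λ (a : Fin m) → sum-cong-≋ (λ (i : Fin n) →
           sum-combine n m (term (combine i a)))) ⟩
    ∑[ a < m ] ∑[ i < n ] ∑[ b < m ] ∑[ j < n ] term (combine i a) (combine j b)
      ≈⟨ sum-cong-≋ (λ (a : Fin m) → ∑-comm (λ (i : Fin n) (b : Fin m) →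
           ∑[ j < n ] term (combine i a) (combine j b))) ⟩
    ∑[ a < m ] ∑[ b < m ] ∑[ i < n ] ∑[ j < n ] term (combine i a) (combine j b)
      ≡⟨ sum-cong-≗ (λ (a : Fin m) → sum-cong-≗ (λ (b : Fin m) →
           sum-cong-≗ (λ (i : Fin n) → sum-cong-≗ (λ (j : Fin n) →
           ≡.cong₂ (λ i′ j′ → (⟦ u (combine i a) ⟧ * W i′ j′) * ⟦ v (combine j b) ⟧)
                   (quotient-combine m i a) (quotient-combine m j b))))) ⟩
    ∑[ a < m ] ∑[ b < m ] bilin (slice m u a) W (slice m v b) ∎
    where
    open SetoidReasoning setoid
    term : Fin (n ℕ.* m) → Fin (n ℕ.* m) → Carrier
    term k l = (⟦ u k ⟧ * kronJ m W k l) * ⟦ v l ⟧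

  -- x^T W y depends on x and y only pointwise (there is no function extensionality).
  bilin-cong : ∀ {n} (W : Matrix n) {x x′ y y′ : BVec n} →
    (∀ i → x i ≡ x′ i) → (∀ j → y j ≡ y′ j) → bilin x W y ≡ bilin x′ W y′
  bilin-cong W x≗x′ y≗y′ = sum-cong-≗ (λ i → sum-cong-≗ (λ j →
    ≡.cong₂ (λ p q → (⟦ p ⟧ * W i j) * ⟦ q ⟧) (x≗x′ i) (y≗y′ j)))

  slice-kron1 : ∀ {n} m (x : BVec n) (a : Fin m) (i : Fin n) → slice m (kron1 m x) a i ≡ x i
  slice-kron1 m x a i = ≡.cong x (quotient-combine m i a)

  bilin-kron1 : ∀ {n} m (W : Matrix n) (x y : BVec n) →
    bilin (kron1 m x) (kronJ m W) (kron1 m y) ≈ (m ℕ.* m) ⊛ bilin x W y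
  bilin-kron1 m W x y = begin
    bilin (kron1 m x) (kronJ m W) (kron1 m y)
      ≈⟨ bilin-kronJ m W _ _ ⟩
    ∑[ a < m ] ∑[ b < m ] bilin (slice m (kron1 m x) a) W (slice m (kron1 m y) b)
      ≡⟨ sum-cong-≗ (λ a → sum-cong-≗ (λ b →
           bilin-cong W (slice-kron1 m x a) (slice-kron1 m y b))) ⟩
    ∑[ a < m ] ∑[ b < m ] bilin x W y
      ≈⟨ sum-cong-≋ {m} (λ _ → sum-replicate m) ⟩
    ∑[ a < m ] (m ⊛ bilin x W y)
      ≈⟨ sum-replicate m ⟩
    m ⊛ (m ⊛ bilin x W y)
      ≈⟨ ×-assocˡ _ m m ⟩
    (m ℕ.* m) ⊛ bilin x W y ∎
    where open SetoidReasoning setoid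

  bilin-kronJ-≤ : ∀ {n} m (W : Matrix n) (M : Carrier) → (∀ x y → bilin x W y ≤ᵣ M) →
    ∀ u v → bilin u (kronJ m W) v ≤ᵣ ((m ℕ.* m) ⊛ M)
  bilin-kronJ-≤ m W M bound u v = begin
    bilin u (kronJ m W) v                                ≈⟨ bilin-kronJ m W u v ⟩
    ∑[ a < m ] ∑[ b < m ] bilin (slice m u a) W (slice m v b)
      ≤⟨ sum-≤-⊛ m _ (m ⊛ M) (λ a → sum-≤-⊛ m _ M (λ b → bound _ _)) ⟩
    m ⊛ (m ⊛ M)                                          ≈⟨ ×-assocˡ M m m ⟩
    (m ℕ.* m) ⊛ M                                        ∎
    where open PosetReasoning ≤-poset

lemma9 : ∀ {c ℓ₁ ℓ₂ : Level} (R : OrderedCommutativeRing c ℓ₁ ℓ₂) →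
    let open OrderedCommutativeRing R using (Carrier) in
    let open Bilinear R in
    (n m : ℕ) → 1 ≤ m → (W : Matrix n) →
    (∀ (M : Carrier) → IsMaxValue W M → IsMaxValue (kronJ m W) ((m ℕ.* m) ⊛ M))
    × (∀ (x y : BVec n) → Maximizes W x y → Maximizes (kronJ m W) (kron1 m x) (kron1 m y))
lemma9 R n m _ W = maxValue , maximizer
  where
  open OrderedCommutativeRing R using (trans; sym; +-monoid)
  open Bilinear R
  open KroneckerMaximum R
  open Poset ≤-poset using (≤-respʳ-≈)
  open MonoidMult +-monoid using (×-congʳ)

  maxValue : ∀ M → IsMaxValue W M → IsMaxValue (kronJ m W) ((m ℕ.* m) ⊛ M)
  maxValue M ((x , y , xWy≈M) , bound) =
    (kron1 m x , kron1 m y , trans (bilin-kron1 m W x y) (×-congʳ (m ℕ.* m) xWy≈M)) ,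
    bilin-kronJ-≤ m W M bound

  maximizer : ∀ x y → Maximizes W x y → Maximizes (kronJ m W) (kron1 m x) (kron1 m y)
  maximizer x y maximal u v =
    ≤-respʳ-≈ (sym (bilin-kron1 m W x y)) (bilin-kronJ-≤ m W (bilin x W y) maximal u v)
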